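{- Let $(\mathfrak M,s)$ and $(\mathfrak M',s')$ be $\omega$-saturated relational pseudo-models with distinguished states $s$ and $s'$ represented in their respective second sorts, and let $\mathcal M=\mathcal M(\mathfrak M)$, $\mathcal M'=\mathcal M(\mathfrak M')$. Then the following are equivalent: (i) $\mathcal M{\downarrow},s\equiv_{\mathsf{InqML}}\mathcal M'{\downarrow},s'$; (ii) for every $w\in s$ there is $w'\in s'$ with $\mathcal M,w\equiv_{\mathsf{InqML}}\mathcal M',w'$, and for every $w'\in s'$ there is $w\in s$ with $\mathcal M,w\equiv_{\mathsf{InqML}}\mathcal M',w'$.
   Context: Fix an at most countable set of propositional variables $(p_i)_{i\in I}$. A pseudo-model is $\mathcal M=(W,\Sigma,V)$ with $W\neq\emptyset$, $\Sigma\colon W\to\mathcal P(\mathcal P(W))\setminus\{\emptyset\}$, $V\colon\{p_i\}\to\mathcal P(W)$; $\sigma(w)=\bigcup\Sigma(w)$. Its inquisitive closure is $\mathcal M{\downarrow}=(W,\Sigma{\downarrow},V)$ with $\Sigma{\downarrow}(w)=\{t:t\subseteq s\text{ for some }s\in\Sigma(w)\}$. $\mathsf{InqML}$: $\phi::=p_i\mid\bot\mid(\phi\wedge\phi)\mid(\phi\to\phi)\mid(\phi\mathbin{\backslash\!/}\phi)\mid\Box\phi\mid\boxplus\phi$, support semantics on $s\subseteq W$: $p_i$: $s\subseteq V(p_i)$; $\bot$: $s=\emptyset$; $\wedge$ componentwise; $\phi\to\psi$: for all $t\subseteq s$, $t\models\phi\Rightarrow t\models\psi$; $\phi\mathbin{\backslash\!/}\psi$: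 $s\models\phi$ or $s\models\psi$; $\Box\phi$: $\sigma(w)\models\phi$ for all $w\in s$; $\boxplus\phi$: $t\models\phi$ for all $w\in s$, $t\in\Sigma(w)$. Write $\mathcal M,w$ for $\mathcal M,\{w\}$, and $\mathcal M,s\equiv_{\mathsf{InqML}}\mathcal M',s'$ if $s$ and $s'$ support exactly the same $\mathsf{InqML}$-formulae. A relational pseudo-model is a two-sorted first-order structure $\mathfrak M=(W,S,\epsilon,E,(P_i)_{i\in I})$, $\epsilon,E\subseteq W\times S$, $P_i\subseteq W$, with extensionality ($\{w:(w,s)\in\epsilon\}=\{w:(w,t)\in\epsilon\}\Rightarrow s=t$) and $E[w]=\{s:(w,s)\in E\}\neq\emptyset$ for all $w$; identify $S\subseteq\mathcal P(W)$ with $\epsilon$ as membership. A state-pointed one $(\mathfrak M,s)$ has $s\in S$. It induces the pseudo-model $\mathcal M(\mathfrak M)=(W,w\mapsto E[w],p_i\mapsto P_i)$. $\mathfrak M$ is $\omega$-saturated if, as a first-order structure, it realises every type (set of formulae in finitely many free variables of either sort) over finitely many parameters that is consistent with its theory with those parameters. -}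

module Defs where

open import Level using (Level; Lift; lift) renaming (zero to 0ℓ; suc to lsuc)
open import Data.Nat using (ℕ)
open import Data.Fin using (Fin)
open import Data.List using (List; []; _∷_)
open import Data.List.Relation.Unary.All using (All)
open import Data.Product using (Σ; ∃; ∃-syntax; _×_; _,_; proj₁; proj₂)
open import Data.Sum using (_⊎_)
open import Data.Empty using (⊥)
open import Relation.Nullary using (¬_)
open import Relation.Binary.PropositionalEquality using (_≡_)
open import Function using (id; _∘_)
open import Function.Bundles using (_⇔_; mk⇔; Equivalence; _↣_)

Subset : Set → Set₁
Subset W = W → Set

_⊆_ : {W : Set} → Subset W → Subset W → Set
s ⊆ t = ∀ w → s w → t w

_≐_ : {W : Set} → Subset W → Subset W → Set
s ≐ t = ∀ w → s w ⇔ t w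

singleton : {W : Set} → W → Subset W
singleton w = λ v → v ≡ w

AtMostCountable : Set → Set
AtMostCountable I = I ↣ ℕ

module _ {I : Set} where

  -- Pseudo-models  M = (W, Σ, V).
  -- Σ(w) is a set of subsets of W (a predicate on subsets, required to
  -- respect extensional equality of subsets), nonempty.
  -- σ(w) = ⋃ Σ(w) is recorded as a field (to keep it a small subset)
  -- together with its defining property.

  record PseudoModel : Set₂ where
    field
      W      : Set
      inhab  : W
      Sig    : W → Subset W → Set₁
      Sig-ext : ∀ {w t t'} → t ≐ t' → Sig w t → Sig w t'
      Sig-ne : ∀ w → Σ (Subset W) (Sig w)
      V      : I → Subset W
      sigma  : W → Subset W
      sigma-def : ∀ w v → sigma w v ⇔ (Σ (Subset W) λ t → Sig w t × t v)

  closure : PseudoModel → PseudoModel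
  closure M = record
    { W = W
    ; inhab = inhab
    ; Sig = λ w t → Σ (Subset W) λ t' → Sig w t' × (t ⊆ t')
    ; Sig-ext = λ { eq (t' , h , sub) →
                    t' , h , (λ v x → sub v (Equivalence.from (eq v) x)) }
    ; Sig-ne = λ w → let (t , h) = Sig-ne w in t , t , h , (λ v x → x)
    ; V = V
    ; sigma = sigma
    ; sigma-def = λ w v → mk⇔
        (λ x → let (t , h , tv) = Equivalence.to (sigma-def w v) x
               in t , (t , h , (λ u y → y)) , tv)
        (λ { (t , (t' , h , sub) , tv) →
               Equivalence.from (sigma-def w v) (t' , h , sub v tv) })
    }
    where open PseudoModel M

  infixr 5 _⇒ᵢ_
  infixr 6 _∧ᵢ_ _⩖_

  data InqML : Set where
    pᵢ    : I → InqML
    ⊥ᵢ    : InqML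
    _∧ᵢ_  : InqML → InqML → InqML
    _⇒ᵢ_  : InqML → InqML → InqML
    _⩖_   : InqML → InqML → InqML
    □ᵢ    : InqML → InqML
    ⊞ᵢ    : InqML → InqML

  _,_⊨_ : (M : PseudoModel) → Subset (PseudoModel.W M) → InqML → Set₁
  M , s ⊨ pᵢ i    = Lift (lsuc 0ℓ) (s ⊆ PseudoModel.V M i)
  M , s ⊨ ⊥ᵢ      = Lift (lsuc 0ℓ) (∀ w → ¬ s w)
  M , s ⊨ (φ ∧ᵢ ψ) = (M , s ⊨ φ) × (M , s ⊨ ψ)
  M , s ⊨ (φ ⇒ᵢ ψ) = ∀ (t : Subset (PseudoModel.W M)) → t ⊆ s →
                       M , t ⊨ φ → M , t ⊨ ψ
  M , s ⊨ (φ ⩖ ψ)  = (M , s ⊨ φ) ⊎ (M , s ⊨ ψ)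
  M , s ⊨ □ᵢ φ     = ∀ w → s w → M , PseudoModel.sigma M w ⊨ φ
  M , s ⊨ ⊞ᵢ φ     = ∀ w → s w → ∀ t → PseudoModel.Sig M w t → M , t ⊨ φ

  InqEquiv : (M : PseudoModel) → Subset (PseudoModel.W M) →
             (M' : PseudoModel) → Subset (PseudoModel.W M') → Set₁
  InqEquiv M s M' s' = ∀ φ → (M , s ⊨ φ) ⇔ (M' , s' ⊨ φ)

  data Sort : Set where
    wS sS : Sort

  record RelPseudoModel : Set₁ where
    field
      W     : Set
      S     : Set
      inhab : W          -- first-order domains are nonempty
      ε     : W → S → Set
      E     : W → S → Set
      P     : I → W → Set
      extensionality : ∀ s t → (∀ w → ε w s ⇔ ε w t) → s ≡ t
      E-ne  : ∀ w → ∃[ s ] E w s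

    Car : Sort → Set
    Car wS = W
    Car sS = S

    ext : S → Subset W
    ext s = λ w → ε w s

  induced : RelPseudoModel → PseudoModel
  induced 𝔐 = record
    { W = W
    ; inhab = inhab
    ; Sig = λ w t → Lift (lsuc 0ℓ) (∃[ s ] (E w s × (t ≐ ext s)))
    ; Sig-ext = λ { eq (lift (s , e , q)) → lift (s , e , λ v → mk⇔
          (λ x → Equivalence.to (q v) (Equivalence.from (eq v) x))
          (λ x → Equivalence.to (eq v) (Equivalence.from (q v) x))) }
    ; Sig-ne = λ w → let (s , e) = E-ne w in
        ext s , lift (s , e , λ v → mk⇔ id id)
    ; V = P
    ; sigma = λ w v → ∃[ s ] (E w s × ε v s)
    ; sigma-def = λ w v → mk⇔
        (λ { (s , e , x) → ext s , lift (s , e , (λ u → mk⇔ id id)) , x })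
        (λ { (t , lift (s , e , q) , tv) → s , e , Equivalence.to (q v) tv })
    }
    where open RelPseudoModel 𝔐

  -- Two-sorted first-order logic over the signature (ε, E, (P_i)),
  -- with k parameters (constants) of prescribed sorts and free
  -- variables given by a context Γ of sorts (de Bruijn).

  data Var : List Sort → Sort → Set where
    vz : ∀ {Γ σ} → Var (σ ∷ Γ) σ
    vs : ∀ {Γ σ τ} → Var Γ σ → Var (τ ∷ Γ) σ

  module _ {k : ℕ} (psort : Fin k → Sort) where

    data Term (Γ : List Sort) : Sort → Set where
      var : ∀ {σ} → Var Γ σ → Term Γ σ
      par : (j : Fin k) → Term Γ (psort j)

    data FO : List Sort → Set where
      εᶠ   : ∀ {Γ} → Term Γ wS → Term Γ sS → FO Γ
      Eᶠ   : ∀ {Γ} → Term Γ wS → Term Γ sS → FO Γ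
      Pᶠ   : ∀ {Γ} → I → Term Γ wS → FO Γ
      eqᶠ  : ∀ {Γ σ} → Term Γ σ → Term Γ σ → FO Γ
      ⊥ᶠ   : ∀ {Γ} → FO Γ
      ¬ᶠ   : ∀ {Γ} → FO Γ → FO Γ
      _∧ᶠ_ : ∀ {Γ} → FO Γ → FO Γ → FO Γ
      _∨ᶠ_ : ∀ {Γ} → FO Γ → FO Γ → FO Γ
      _⇒ᶠ_ : ∀ {Γ} → FO Γ → FO Γ → FO Γ
      ∀ᶠ   : ∀ {Γ} (σ : Sort) → FO (σ ∷ Γ) → FO Γ
      ∃ᶠ   : ∀ {Γ} (σ : Sort) → FO (σ ∷ Γ) → FO Γ

  module _ (𝔐 : RelPseudoModel) where
    open RelPseudoModel 𝔐

    Env : List Sort → Set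
    Env Γ = ∀ {σ} → Var Γ σ → Car σ

    extend : ∀ {Γ σ} → Car σ → Env Γ → Env (σ ∷ Γ)
    extend a ρ vz     = a
    extend a ρ (vs x) = ρ x

    module _ {k : ℕ} {psort : Fin k → Sort}
             (pval : (j : Fin k) → Car (psort j)) where

      evalT : ∀ {Γ σ} → Env Γ → Term psort Γ σ → Car σ
      evalT ρ (var x) = ρ x
      evalT ρ (par j) = pval j

      Sat : ∀ {Γ} → Env Γ → FO psort Γ → Set
      Sat ρ (εᶠ t u)   = ε (evalT ρ t) (evalT ρ u)
      Sat ρ (Eᶠ t u)   = E (evalT ρ t) (evalT ρ u)
      Sat ρ (Pᶠ i t)   = P i (evalT ρ t)
      Sat ρ (eqᶠ t u)  = evalT ρ t ≡ evalT ρ u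
      Sat ρ ⊥ᶠ         = ⊥
      Sat ρ (¬ᶠ φ)     = ¬ Sat ρ φ
      Sat ρ (φ ∧ᶠ ψ)   = Sat ρ φ × Sat ρ ψ
      Sat ρ (φ ∨ᶠ ψ)   = Sat ρ φ ⊎ Sat ρ ψ
      Sat ρ (φ ⇒ᶠ ψ)   = Sat ρ φ → Sat ρ ψ
      Sat ρ (∀ᶠ σ φ)   = ∀ (a : Car σ) → Sat (extend a ρ) φ
      Sat ρ (∃ᶠ σ φ)   = Σ (Car σ) λ a → Sat (extend a ρ) φ

      -- a type p (set of formulae in the free variables Γ, over the
      -- parameters) is consistent with the theory of (𝔐, parameters)
      -- iff it is finitely satisfiable in (𝔐, parameters).
      FinitelySatisfiable : ∀ {Γ} → (FO psort Γ → Set) → Set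
      FinitelySatisfiable {Γ} p =
        ∀ (φs : List (FO psort Γ)) → All p φs →
          Σ (Env Γ) λ ρ → All (Sat ρ) φs

      Realised : ∀ {Γ} → (FO psort Γ → Set) → Set
      Realised {Γ} p = Σ (Env Γ) λ ρ → ∀ φ → p φ → Sat ρ φ

    ωSaturated : Set₁
    ωSaturated =
      ∀ (k : ℕ) (psort : Fin k → Sort) (pval : (j : Fin k) → Car (psort j))
        (Γ : List Sort) (p : FO psort Γ → Set) →
        FinitelySatisfiable pval p → Realised pval p

module Submission where

-- Support in M↓ and in M coincide, so the closures can be dropped. For (ii) ⇒ (i), the
-- Egli–Milner lifting of a relation between worlds that implies InqML-equivalence yields
-- InqML-equivalence of states: atoms and modalities are flat, and for an implication a
-- subset of one state is matched by the worlds of the other related to it. For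
-- (i) ⇒ (ii), each formula χ is resolved into a list of first-order formulas such that a
-- state supports χ iff one of them holds throughout the state; their disjunction is a
-- first-order translation of support at a world. The translations true at w ∈ s,
-- together with "x ∈ s'", form a finitely satisfiable type of 𝔐', and a realisation w'
-- agrees with w on all formulas, positive ones by construction and the others via
-- negation and excluded middle.

open import Defs
open import Level using (lift; lower) renaming (zero to 0ℓ; suc to lsuc)
open import Axiom.ExcludedMiddle using (ExcludedMiddle)
open import Data.Nat using (ℕ)
open import Data.Fin using (Fin; zero)
open import Data.Product using (Σ; ∃-syntax; _×_; _,_; proj₁; proj₂)
open import Data.Sum using (_⊎_; inj₁; inj₂)
import Data.Sum as Sum
open import Data.Empty using (⊥-elim)
open import Data.List using (List; []; _∷_; [_]; _++_; map; cartesianProductWith)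
open import Data.List.Relation.Unary.Any as Any using (Any; here; there)
open import Data.List.Relation.Unary.Any.Properties
  using (++⁺ˡ; ++⁺ʳ; ++⁻; map⁺; map⁻; cartesianProductWith⁺; cartesianProductWith⁻)
open import Data.List.Relation.Unary.All using (All; []; _∷_; tabulate; lookupAny)
open import Data.List.Membership.Propositional using (_∈_; lose)
open import Relation.Nullary using (¬_; yes; no)
open import Relation.Binary.PropositionalEquality using (_≡_; refl; sym; trans; subst; subst₂)
open import Function using (id; _∘_)
open import Function.Bundles using (_⇔_; mk⇔; Equivalence)
import Function.Properties.Equivalence as ⇔

open Equivalence

⊤ᵢ : ∀ {I} → InqML {I}
⊤ᵢ = ⊥ᵢ ⇒ᵢ ⊥ᵢ

¬ᵢ : ∀ {I} → InqML {I} → InqML {I}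
¬ᵢ φ = φ ⇒ᵢ ⊥ᵢ

module _ {I : Set} (M : PseudoModel {I}) where
  open PseudoModel M

  ⊨-persistent : ∀ φ {t t' : Subset W} → t ⊆ t' → M , t' ⊨ φ → M , t ⊨ φ
  ⊨-persistent (pᵢ i)   t⊆t' (lift h) = lift (λ w tw → h w (t⊆t' w tw))
  ⊨-persistent ⊥ᵢ       t⊆t' (lift h) = lift (λ w tw → h w (t⊆t' w tw))
  ⊨-persistent (φ ∧ᵢ ψ) t⊆t' (hφ , hψ) = ⊨-persistent φ t⊆t' hφ , ⊨-persistent ψ t⊆t' hψ
  ⊨-persistent (φ ⇒ᵢ ψ) t⊆t' h u u⊆t = h u (λ w uw → t⊆t' w (u⊆t w uw))
  ⊨-persistent (φ ⩖ ψ)  t⊆t' (inj₁ hφ) = inj₁ (⊨-persistent φ t⊆t' hφ)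
  ⊨-persistent (φ ⩖ ψ)  t⊆t' (inj₂ hψ) = inj₂ (⊨-persistent ψ t⊆t' hψ)
  ⊨-persistent (□ᵢ φ)   t⊆t' h w tw = h w (t⊆t' w tw)
  ⊨-persistent (⊞ᵢ φ)   t⊆t' h w tw = h w (t⊆t' w tw)

  ⊨-closure : ∀ φ (t : Subset W) → (M , t ⊨ φ) ⇔ (closure M , t ⊨ φ)
  ⊨-closure (pᵢ i)   t = ⇔.refl
  ⊨-closure ⊥ᵢ       t = ⇔.refl
  ⊨-closure (φ ∧ᵢ ψ) t = mk⇔
    (λ (hφ , hψ) → to (⊨-closure φ t) hφ , to (⊨-closure ψ t) hψ)
    (λ (hφ , hψ) → from (⊨-closure φ t) hφ , from (⊨-closure ψ t) hψ)
  ⊨-closure (φ ⇒ᵢ ψ) t = mk⇔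
    (λ h u u⊆t hφ → to (⊨-closure ψ u) (h u u⊆t (from (⊨-closure φ u) hφ)))
    (λ h u u⊆t hφ → from (⊨-closure ψ u) (h u u⊆t (to (⊨-closure φ u) hφ)))
  ⊨-closure (φ ⩖ ψ)  t = mk⇔
    (λ { (inj₁ hφ) → inj₁ (to (⊨-closure φ t) hφ) ; (inj₂ hψ) → inj₂ (to (⊨-closure ψ t) hψ) })
    (λ { (inj₁ hφ) → inj₁ (from (⊨-closure φ t) hφ) ; (inj₂ hψ) → inj₂ (from (⊨-closure ψ t) hψ) })
  ⊨-closure (□ᵢ φ)   t = mk⇔
    (λ h w tw → to (⊨-closure φ (sigma w)) (h w tw))
    (λ h w tw → from (⊨-closure φ (sigma w)) (h w tw))
  ⊨-closure (⊞ᵢ φ)   t = mk⇔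
    (λ h w tw u (u' , u'∈Σw , u⊆u') → to (⊨-closure φ u) (⊨-persistent φ u⊆u' (h w tw u' u'∈Σw)))
    (λ h w tw u u∈Σw → from (⊨-closure φ u) (h w tw u (u , u∈Σw , λ _ → id)))

  ⊨⊤ᵢ : ∀ (t : Subset W) → M , t ⊨ ⊤ᵢ
  ⊨⊤ᵢ t u _ = id

  ⊨¬ : ∀ φ (t : Subset W) →
       (M , t ⊨ ¬ᵢ φ) ⇔ (∀ w → t w → ¬ (M , singleton w ⊨ φ))
  ⊨¬ φ t = mk⇔
    (λ h w tw hφ → lower (h (singleton w) (λ v v≡w → subst t (sym v≡w) tw) hφ) w refl)
    (λ h u u⊆t hφ → lift (λ w uw →
       h w (u⊆t w uw) (⊨-persistent φ (λ v v≡w → subst u (sym v≡w) uw) hφ)))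

  Flat : InqML {I} → Set₁
  Flat φ = ∀ t → (M , t ⊨ φ) ⇔ (∀ w → t w → M , singleton w ⊨ φ)

  pᵢ-flat : ∀ i → Flat (pᵢ i)
  pᵢ-flat i t = mk⇔
    (λ (lift t⊆Vi) w tw → lift (λ v v≡w → subst (V i) (sym v≡w) (t⊆Vi w tw)))
    (λ h → lift (λ w tw → lower (h w tw) w refl))

  □ᵢ-flat : ∀ φ → Flat (□ᵢ φ)
  □ᵢ-flat φ t = mk⇔
    (λ h w tw v v≡w → h v (subst t (sym v≡w) tw))
    (λ h w tw → h w tw w refl)

  ⊞ᵢ-flat : ∀ φ → Flat (⊞ᵢ φ)
  ⊞ᵢ-flat φ t = mk⇔
    (λ h w tw v v≡w → h v (subst t (sym v≡w) tw))
    (λ h w tw → h w tw w refl)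

InqEquiv-sym : ∀ {I} {M M' : PseudoModel {I}} {t t'} → InqEquiv M t M' t' → InqEquiv M' t' M t
InqEquiv-sym e φ = ⇔.sym (e φ)

InqEquiv-closure : ∀ {I} (M M' : PseudoModel {I}) t t' →
                   InqEquiv (closure M) t (closure M') t' ⇔ InqEquiv M t M' t'
InqEquiv-closure M M' t t' = mk⇔
  (λ e φ → ⇔.trans (⊨-closure M φ t) (⇔.trans (e φ) (⇔.sym (⊨-closure M' φ t'))))
  (λ e φ → ⇔.trans (⇔.sym (⊨-closure M φ t)) (⇔.trans (e φ) (⊨-closure M' φ t')))

module _ {I : Set} {M M' : PseudoModel {I}} where
  open PseudoModel M using (W)
  open PseudoModel M' using () renaming (W to W')

  module _ (R : W → W' → Set)
           (R⇒≡ : ∀ {w w'} → R w w' → InqEquiv M (singleton w) M' (singleton w')) where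

    EgliMilner : Subset W → Subset W' → Set
    EgliMilner t t' = (∀ w → t w → ∃[ w' ] t' w' × R w w')
                    × (∀ w' → t' w' → ∃[ w ] t w × R w w')

    restrictˡ : Subset W → Subset W' → Subset W
    restrictˡ t u' w = t w × ∃[ w' ] u' w' × R w w'

    restrictʳ : Subset W → Subset W' → Subset W'
    restrictʳ u t' w' = t' w' × ∃[ w ] u w × R w w'

    restrictˡ-EgliMilner : ∀ {t t' u'} → EgliMilner t t' → u' ⊆ t' → EgliMilner (restrictˡ t u') u'
    restrictˡ-EgliMilner (_ , back) u'⊆t' =
      (λ w (_ , w' , u'w' , Rww') → w' , u'w' , Rww')
      , λ w' u'w' → let (w , tw , Rww') = back w' (u'⊆t' w' u'w') in w , (tw , w' , u'w' , Rww') , Rww'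

    restrictʳ-EgliMilner : ∀ {t t' u} → EgliMilner t t' → u ⊆ t → EgliMilner u (restrictʳ u t')
    restrictʳ-EgliMilner (forth , _) u⊆t =
      (λ w uw → let (w' , t'w' , Rww') = forth w (u⊆t w uw) in w' , (t'w' , w , uw , Rww') , Rww')
      , λ w' (_ , w , uw , Rww') → w , uw , Rww'

    flat-transfer : ∀ φ → Flat M φ → Flat M' φ → ∀ {t t'} → EgliMilner t t' →
                    (M , t ⊨ φ) ⇔ (M' , t' ⊨ φ)
    flat-transfer φ flat flat' {t} {t'} (forth , back) = mk⇔
      (λ h → from (flat' t') λ w' t'w' →
         let (w , tw , Rww') = back w' t'w' in to (R⇒≡ Rww' φ) (to (flat t) h w tw))
      (λ h → from (flat t) λ w tw →
         let (w' , t'w' , Rww') = forth w tw in from (R⇒≡ Rww' φ) (to (flat' t') h w' t'w'))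

    EgliMilner⇒InqEquiv : ∀ {t t'} → EgliMilner t t' → InqEquiv M t M' t'
    EgliMilner⇒InqEquiv rel (pᵢ i) = flat-transfer (pᵢ i) (pᵢ-flat M i) (pᵢ-flat M' i) rel
    EgliMilner⇒InqEquiv (forth , back) ⊥ᵢ = mk⇔
      (λ (lift t∅) → lift (λ w' t'w' → let (w , tw , _) = back w' t'w' in t∅ w tw))
      (λ (lift t'∅) → lift (λ w tw → let (w' , t'w' , _) = forth w tw in t'∅ w' t'w'))
    EgliMilner⇒InqEquiv rel (φ ∧ᵢ ψ) = mk⇔
      (λ (hφ , hψ) → to (EgliMilner⇒InqEquiv rel φ) hφ , to (EgliMilner⇒InqEquiv rel ψ) hψ)
      (λ (hφ , hψ) → from (EgliMilner⇒InqEquiv rel φ) hφ , from (EgliMilner⇒InqEquiv rel ψ) hψ)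
    EgliMilner⇒InqEquiv {t} {t'} rel (φ ⇒ᵢ ψ) = mk⇔
      (λ h u' u'⊆t' hφ →
         let relᵤ = restrictˡ-EgliMilner rel u'⊆t' in
         to (EgliMilner⇒InqEquiv relᵤ ψ)
           (h (restrictˡ t u') (λ _ → proj₁) (from (EgliMilner⇒InqEquiv relᵤ φ) hφ)))
      (λ h u u⊆t hφ →
         let relᵤ = restrictʳ-EgliMilner rel u⊆t in
         from (EgliMilner⇒InqEquiv relᵤ ψ)
           (h (restrictʳ u t') (λ _ → proj₁) (to (EgliMilner⇒InqEquiv relᵤ φ) hφ)))
    EgliMilner⇒InqEquiv rel (φ ⩖ ψ) = mk⇔
      (λ { (inj₁ hφ) → inj₁ (to (EgliMilner⇒InqEquiv rel φ) hφ)
         ; (inj₂ hψ) → inj₂ (to (EgliMilner⇒InqEquiv rel ψ) hψ) })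
      (λ { (inj₁ hφ) → inj₁ (from (EgliMilner⇒InqEquiv rel φ) hφ)
         ; (inj₂ hψ) → inj₂ (from (EgliMilner⇒InqEquiv rel ψ) hψ) })
    EgliMilner⇒InqEquiv rel (□ᵢ φ) = flat-transfer (□ᵢ φ) (□ᵢ-flat M φ) (□ᵢ-flat M' φ) rel
    EgliMilner⇒InqEquiv rel (⊞ᵢ φ) = flat-transfer (⊞ᵢ φ) (⊞ᵢ-flat M φ) (⊞ᵢ-flat M' φ) rel

  -- InqEquiv is large and cannot carve out subsets; the graph of the two matchings is a small substitute.
  matchings⇒InqEquiv : ∀ {t t'} →
                       (∀ w → t w → Σ W' λ w' → t' w' × InqEquiv M (singleton w) M' (singleton w')) →
                       (∀ w' → t' w' → Σ W λ w → t w × InqEquiv M (singleton w) M' (singleton w')) →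
                       InqEquiv M t M' t'
  matchings⇒InqEquiv {t} {t'} f g = EgliMilner⇒InqEquiv graph graph⇒≡ (forth , back)
    where
      graph : W → W' → Set
      graph w w' = (Σ (t w) λ tw → proj₁ (f w tw) ≡ w') ⊎ (Σ (t' w') λ t'w' → proj₁ (g w' t'w') ≡ w)

      graph⇒≡ : ∀ {w w'} → graph w w' → InqEquiv M (singleton w) M' (singleton w')
      graph⇒≡ (inj₁ (tw , refl)) = proj₂ (proj₂ (f _ tw))
      graph⇒≡ (inj₂ (t'w' , refl)) = proj₂ (proj₂ (g _ t'w'))

      forth : ∀ w → t w → ∃[ w' ] t' w' × graph w w'
      forth w tw = proj₁ (f w tw) , proj₁ (proj₂ (f w tw)) , inj₁ (tw , refl)

      back : ∀ w' → t' w' → ∃[ w ] t w × graph w w'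
      back w' t'w' = proj₁ (g w' t'w') , proj₁ (proj₂ (g w' t'w')) , inj₂ (t'w' , refl)

module _ {I : Set} {k : ℕ} {psort : Fin k → Sort {I}} where

  ⊤ᶠ : ∀ {Γ} → FO psort Γ
  ⊤ᶠ = ⊥ᶠ ⇒ᶠ ⊥ᶠ

  ⋁ᶠ : ∀ {Γ} → List (FO psort Γ) → FO psort Γ
  ⋁ᶠ []       = ⊥ᶠ
  ⋁ᶠ (R ∷ Rs) = R ∨ᶠ ⋁ᶠ Rs

  -- One formula ⋀_{a ∈ As} (a ⇒ b_a) for every choice function a ↦ b_a ∈ Bs.
  choices : ∀ {Γ} → List (FO psort Γ) → List (FO psort Γ) → List (FO psort Γ)
  choices []       Bs = [ ⊤ᶠ ]
  choices (a ∷ As) Bs = cartesianProductWith (λ b q → (a ⇒ᶠ b) ∧ᶠ q) Bs (choices As Bs)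

  -- De Bruijn: in a body, vz is the world just bound; the world (and, for ⊞,
  -- the state) of the enclosing modality sit behind it.
  □-body : ∀ {Γ} → FO psort (wS ∷ wS ∷ Γ) → FO psort (wS ∷ Γ)
  □-body R = ∀ᶠ wS (∃ᶠ sS (Eᶠ (var (vs (vs vz))) (var vz) ∧ᶠ εᶠ (var (vs vz)) (var vz)) ⇒ᶠ R)

  ⊞-body : ∀ {Γ} → FO psort (wS ∷ sS ∷ wS ∷ Γ) → FO psort (sS ∷ wS ∷ Γ)
  ⊞-body R = ∀ᶠ wS (εᶠ (var vz) (var (vs vz)) ⇒ᶠ R)

  □-resolution : ∀ {Γ} → List (FO psort (wS ∷ wS ∷ Γ)) → FO psort (wS ∷ Γ)
  □-resolution Rs = ⋁ᶠ (map □-body Rs)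

  ⊞-resolution : ∀ {Γ} → List (FO psort (wS ∷ sS ∷ wS ∷ Γ)) → FO psort (wS ∷ Γ)
  ⊞-resolution Rs = ∀ᶠ sS (Eᶠ (var (vs vz)) (var vz) ⇒ᶠ ⋁ᶠ (map ⊞-body Rs))

  resolutions : InqML {I} → (Γ : List Sort) → List (FO psort (wS ∷ Γ))
  resolutions (pᵢ i)   Γ = [ Pᶠ i (var vz) ]
  resolutions ⊥ᵢ       Γ = [ ⊥ᶠ ]
  resolutions (φ ∧ᵢ ψ) Γ = cartesianProductWith _∧ᶠ_ (resolutions φ Γ) (resolutions ψ Γ)
  resolutions (φ ⇒ᵢ ψ) Γ = choices (resolutions φ Γ) (resolutions ψ Γ)
  resolutions (φ ⩖ ψ)  Γ = resolutions φ Γ ++ resolutions ψ Γ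
  resolutions (□ᵢ φ)   Γ = [ □-resolution (resolutions φ (wS ∷ Γ)) ]
  resolutions (⊞ᵢ φ)   Γ = [ ⊞-resolution (resolutions φ (sS ∷ wS ∷ Γ)) ]

  standardTranslation : InqML {I} → FO psort (wS ∷ [])
  standardTranslation χ = ⋁ᶠ (resolutions χ [])

ρ₀ : ∀ {I} {𝔐 : RelPseudoModel {I}} → Env 𝔐 []
ρ₀ ()

module _ {I : Set} {𝔐 : RelPseudoModel {I}} where
  open RelPseudoModel 𝔐 using (Car)

  _≗ᵉ_ : ∀ {Γ} → Env 𝔐 Γ → Env 𝔐 Γ → Set
  ρ ≗ᵉ ρ' = ∀ {σ} (x : Var _ σ) → ρ x ≡ ρ' x

  extend-cong : ∀ {Γ σ} {ρ ρ' : Env 𝔐 Γ} → ρ ≗ᵉ ρ' → (a : Car σ) →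
                extend 𝔐 {σ = σ} a ρ ≗ᵉ extend 𝔐 a ρ'
  extend-cong ρ≗ρ' a vz     = refl
  extend-cong ρ≗ρ' a (vs x) = ρ≗ρ' x

module _ {I : Set} (𝔐 : RelPseudoModel {I}) {k : ℕ} {psort : Fin k → Sort}
         (pval : (j : Fin k) → RelPseudoModel.Car 𝔐 (psort j)) where
  open RelPseudoModel 𝔐

  private
    M : PseudoModel {I}
    M = induced 𝔐
    ⟦_⟧ : ∀ {Γ} → Env 𝔐 Γ → FO psort Γ → Set
    ⟦_⟧ = Sat 𝔐 pval

  evalT-cong : ∀ {Γ σ} {ρ ρ' : Env 𝔐 Γ} → ρ ≗ᵉ ρ' → (u : Term psort Γ σ) →
               evalT 𝔐 pval ρ u ≡ evalT 𝔐 pval ρ' u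
  evalT-cong ρ≗ρ' (var x) = ρ≗ρ' x
  evalT-cong ρ≗ρ' (par j) = refl

  Sat-cong : ∀ {Γ} {ρ ρ' : Env 𝔐 Γ} → ρ ≗ᵉ ρ' → (φ : FO psort Γ) → ⟦ ρ ⟧ φ → ⟦ ρ' ⟧ φ
  Sat-cong ρ≗ρ' (εᶠ t u)  h = subst₂ ε (evalT-cong ρ≗ρ' t) (evalT-cong ρ≗ρ' u) h
  Sat-cong ρ≗ρ' (Eᶠ t u)  h = subst₂ E (evalT-cong ρ≗ρ' t) (evalT-cong ρ≗ρ' u) h
  Sat-cong ρ≗ρ' (Pᶠ i t)  h = subst (P i) (evalT-cong ρ≗ρ' t) h
  Sat-cong ρ≗ρ' (eqᶠ t u) h = trans (sym (evalT-cong ρ≗ρ' t)) (trans h (evalT-cong ρ≗ρ' u))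
  Sat-cong ρ≗ρ' ⊥ᶠ        h = h
  Sat-cong ρ≗ρ' (¬ᶠ φ)    h = h ∘ Sat-cong (sym ∘ ρ≗ρ') φ
  Sat-cong ρ≗ρ' (φ ∧ᶠ ψ)  (hφ , hψ) = Sat-cong ρ≗ρ' φ hφ , Sat-cong ρ≗ρ' ψ hψ
  Sat-cong ρ≗ρ' (φ ∨ᶠ ψ)  (inj₁ hφ) = inj₁ (Sat-cong ρ≗ρ' φ hφ)
  Sat-cong ρ≗ρ' (φ ∨ᶠ ψ)  (inj₂ hψ) = inj₂ (Sat-cong ρ≗ρ' ψ hψ)
  Sat-cong ρ≗ρ' (φ ⇒ᶠ ψ)  h = Sat-cong ρ≗ρ' ψ ∘ h ∘ Sat-cong (sym ∘ ρ≗ρ') φ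
  Sat-cong ρ≗ρ' (∀ᶠ σ φ)  h a = Sat-cong (extend-cong {σ = σ} ρ≗ρ' a) φ (h a)
  Sat-cong ρ≗ρ' (∃ᶠ σ φ)  (a , h) = a , Sat-cong (extend-cong {σ = σ} ρ≗ρ' a) φ h

  TrueOn : ∀ {Γ} → Env 𝔐 Γ → Subset W → FO psort (wS ∷ Γ) → Set
  TrueOn ρ t R = ∀ w → t w → ⟦ extend 𝔐 w ρ ⟧ R

  Sat-⋁ᶠ : ∀ {Γ} {ρ : Env 𝔐 Γ} Rs → ⟦ ρ ⟧ (⋁ᶠ Rs) ⇔ Any ⟦ ρ ⟧ Rs
  Sat-⋁ᶠ Rs = mk⇔ (to-⋁ Rs) from-⋁
    where
      to-⋁ : ∀ {Γ} {ρ : Env 𝔐 Γ} Rs → ⟦ ρ ⟧ (⋁ᶠ Rs) → Any ⟦ ρ ⟧ Rs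
      to-⋁ (R ∷ Rs) (inj₁ hR)  = here hR
      to-⋁ (R ∷ Rs) (inj₂ hRs) = there (to-⋁ Rs hRs)
      from-⋁ : ∀ {Γ} {ρ : Env 𝔐 Γ} {Rs} → Any ⟦ ρ ⟧ Rs → ⟦ ρ ⟧ (⋁ᶠ Rs)
      from-⋁ (here hR)   = inj₁ hR
      from-⋁ (there hRs) = inj₂ (from-⋁ hRs)

  Sat-⋁ᶠ-map : ∀ {Γ Δ} {ρ : Env 𝔐 Γ} (f : FO psort Δ → FO psort Γ) Rs →
               ⟦ ρ ⟧ (⋁ᶠ (map f Rs)) ⇔ Any (⟦ ρ ⟧ ∘ f) Rs
  Sat-⋁ᶠ-map f Rs = mk⇔ (map⁻ ∘ to (Sat-⋁ᶠ (map f Rs))) (from (Sat-⋁ᶠ (map f Rs)) ∘ map⁺)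

  Entails : ∀ {Γ} → Env 𝔐 Γ → Subset W → FO psort (wS ∷ Γ) → FO psort (wS ∷ Γ) → Set
  Entails ρ t a b = ∀ w → t w → ⟦ extend 𝔐 w ρ ⟧ a → ⟦ extend 𝔐 w ρ ⟧ b

  choices-TrueOn : ∀ {Γ} {ρ : Env 𝔐 Γ} {t} As Bs →
    Any (TrueOn ρ t) (choices As Bs) ⇔ All (λ a → Any (Entails ρ t a) Bs) As
  choices-TrueOn []       Bs = mk⇔ (λ _ → []) (λ _ → here (λ _ _ → id))
  choices-TrueOn {ρ = ρ} {t} (a ∷ As) Bs = mk⇔
    (λ h → let (ab , rest) = cartesianProductWith⁻ _ (λ {b} {q} → split b q) Bs (choices As Bs) h
           in ab ∷ to (choices-TrueOn As Bs) rest)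
    (λ { (ab ∷ rest) → cartesianProductWith⁺ _ (λ {b} {q} → join b q) ab (from (choices-TrueOn As Bs) rest) })
    where
      split : ∀ b q → TrueOn ρ t ((a ⇒ᶠ b) ∧ᶠ q) → Entails ρ t a b × TrueOn ρ t q
      split _ _ h = (λ w tw → proj₁ (h w tw)) , (λ w tw → proj₂ (h w tw))
      join : ∀ b q → Entails ρ t a b → TrueOn ρ t q → TrueOn ρ t ((a ⇒ᶠ b) ∧ᶠ q)
      join _ _ ab q w tw = ab w tw , q w tw

  Resolves : ∀ {Γ} → Env 𝔐 Γ → InqML {I} → List (FO psort (wS ∷ Γ)) → Set₁
  Resolves ρ φ Rs = ∀ t → (M , t ⊨ φ) ⇔ Any (TrueOn ρ t) Rs

  module _ {Γ} {ρ : Env 𝔐 Γ} {φ ψ : InqML {I}} {As Bs : List (FO psort (wS ∷ Γ))}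
           (φ-As : Resolves ρ φ As) (ψ-Bs : Resolves ρ ψ Bs) where

    cartesianProduct-resolves-∧ : Resolves ρ (φ ∧ᵢ ψ) (cartesianProductWith _∧ᶠ_ As Bs)
    cartesianProduct-resolves-∧ t = mk⇔
      (λ (hφ , hψ) → cartesianProductWith⁺ _∧ᶠ_ (λ hA hB w tw → hA w tw , hB w tw)
                       (to (φ-As t) hφ) (to (ψ-Bs t) hψ))
      (λ h → let (hA , hB) = cartesianProductWith⁻ _∧ᶠ_
                                (λ hAB → (λ w tw → proj₁ (hAB w tw)) , (λ w tw → proj₂ (hAB w tw)))
                                As Bs h
             in from (φ-As t) hA , from (ψ-Bs t) hB)

    ++-resolves-⩖ : Resolves ρ (φ ⩖ ψ) (As ++ Bs)
    ++-resolves-⩖ t = mk⇔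
      (Sum.[ ++⁺ˡ ∘ to (φ-As t) , ++⁺ʳ As ∘ to (ψ-Bs t) ])
      (Sum.map (from (φ-As t)) (from (ψ-Bs t)) ∘ ++⁻ As)

    choices-resolve-⇒ : Resolves ρ (φ ⇒ᵢ ψ) (choices As Bs)
    choices-resolve-⇒ t = mk⇔
      (λ h → from (choices-TrueOn As Bs) (tabulate (entailed h)))
      (λ h u u⊆t hφ →
         let (ab , ha) = lookupAny (to (choices-TrueOn As Bs) h) (to (φ-As u) hφ)
         in from (ψ-Bs u) (Any.map (λ ab w uw → ab w (u⊆t w uw) (ha w uw)) ab))
      where
        -- Apply the implication to the part of t where the resolution a of φ is true.
        entailed : M , t ⊨ (φ ⇒ᵢ ψ) → ∀ {a} → a ∈ As → Any (Entails ρ t a) Bs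
        entailed h {a} a∈As =
          let tₐ = λ w → t w × ⟦ extend 𝔐 w ρ ⟧ a in
          Any.map (λ hb w tw ha → hb w (tw , ha))
            (to (ψ-Bs tₐ) (h tₐ (λ _ → proj₁) (from (φ-As tₐ) (lose a∈As (λ _ → proj₂)))))

  □-resolves : ∀ {Γ} {ρ : Env 𝔐 Γ} {φ Rs} → (∀ w → Resolves (extend 𝔐 w ρ) φ Rs) →
               Resolves ρ (□ᵢ φ) [ □-resolution Rs ]
  □-resolves {Rs = Rs} φ-Rs t = mk⇔
    (λ h → here λ w tw → from (Sat-⋁ᶠ-map □-body Rs) (to (φ-Rs w (sigma w)) (h w tw)))
    (λ { (here h) w tw → from (φ-Rs w (sigma w)) (to (Sat-⋁ᶠ-map □-body Rs) (h w tw)) })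
    where open PseudoModel M using (sigma)

  ⊞-resolves : ∀ {Γ} {ρ : Env 𝔐 Γ} {φ Rs} → (∀ w a → Resolves (extend 𝔐 a (extend 𝔐 w ρ)) φ Rs) →
               Resolves ρ (⊞ᵢ φ) [ ⊞-resolution Rs ]
  ⊞-resolves {φ = φ} {Rs} φ-Rs t = mk⇔
    (λ h → here λ w tw a Ewa →
       from (Sat-⋁ᶠ-map ⊞-body Rs) (to (φ-Rs w a (ext a)) (h w tw (ext a) (lift (a , Ewa , λ _ → ⇔.refl)))))
    (λ { (here h) w tw u (lift (a , Ewa , u≐a)) →
       ⊨-persistent M φ (λ v uv → to (u≐a v) uv)
         (from (φ-Rs w a (ext a)) (to (Sat-⋁ᶠ-map ⊞-body Rs) (h w tw a Ewa))) })

  resolutions-resolve : ∀ φ Γ (ρ : Env 𝔐 Γ) → Resolves ρ φ (resolutions φ Γ)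
  resolutions-resolve (pᵢ i)   Γ ρ t = mk⇔ (λ (lift h) → here h) (λ { (here h) → lift h })
  resolutions-resolve ⊥ᵢ       Γ ρ t = mk⇔ (λ (lift h) → here h) (λ { (here h) → lift h })
  resolutions-resolve (φ ∧ᵢ ψ) Γ ρ =
    cartesianProduct-resolves-∧ (resolutions-resolve φ Γ ρ) (resolutions-resolve ψ Γ ρ)
  resolutions-resolve (φ ⇒ᵢ ψ) Γ ρ =
    choices-resolve-⇒ (resolutions-resolve φ Γ ρ) (resolutions-resolve ψ Γ ρ)
  resolutions-resolve (φ ⩖ ψ)  Γ ρ = ++-resolves-⩖ (resolutions-resolve φ Γ ρ) (resolutions-resolve ψ Γ ρ)
  resolutions-resolve (□ᵢ φ)   Γ ρ = □-resolves λ w → resolutions-resolve φ (wS ∷ Γ) (extend 𝔐 w ρ)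
  resolutions-resolve (⊞ᵢ φ)   Γ ρ =
    ⊞-resolves λ w a → resolutions-resolve φ (sS ∷ wS ∷ Γ) (extend 𝔐 a (extend 𝔐 w ρ))

  standardTranslation-correct : ∀ χ w →
    ⟦ extend 𝔐 w ρ₀ ⟧ (standardTranslation χ) ⇔ (M , singleton w ⊨ χ)
  standardTranslation-correct χ w = mk⇔
    (λ h → from (resolutions-resolve χ [] ρ₀ (singleton w))
             (Any.map (λ { hR _ refl → hR }) (to (Sat-⋁ᶠ (resolutions χ [])) h)))
    (λ h → from (Sat-⋁ᶠ (resolutions χ []))
             (Any.map (λ hR → hR w refl) (to (resolutions-resolve χ [] ρ₀ (singleton w)) h)))

module _ (em : ExcludedMiddle (lsuc 0ℓ)) {I : Set} (𝔐 𝔐' : RelPseudoModel {I})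
         (s : RelPseudoModel.S 𝔐) (s' : RelPseudoModel.S 𝔐') (saturated' : ωSaturated 𝔐')
         (s≡s' : InqEquiv (induced 𝔐) (RelPseudoModel.ext 𝔐 s)
                          (induced 𝔐') (RelPseudoModel.ext 𝔐' s')) where
  open RelPseudoModel 𝔐 using (W; ε; ext)
  open RelPseudoModel 𝔐' using () renaming (W to W'; ε to ε'; ext to ext')

  private
    M M' : PseudoModel {I}
    M  = induced 𝔐
    M' = induced 𝔐'

  stateSort : Fin 1 → Sort {I}
  stateSort _ = sS

  inState∧ : InqML {I} → FO stateSort (wS ∷ [])
  inState∧ χ = εᶠ (var vz) (par zero) ∧ᶠ standardTranslation χ

  positiveType : W → FO stateSort (wS ∷ []) → Set
  positiveType w φ = Σ (InqML {I}) λ χ → φ ≡ inState∧ χ × Sat 𝔐 (λ _ → s) (extend 𝔐 w ρ₀) φ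

  -- If no world of s' supported ψ, then s' would support ¬ψ, and so would s ∋ w.
  supportingWorld : ∀ {w} → ε w s → ∀ ψ → M , singleton w ⊨ ψ →
                    Σ W' λ w' → ε' w' s' × (M' , singleton w' ⊨ ψ)
  supportingWorld {w} ws ψ wψ with em {Σ W' λ w' → ε' w' s' × (M' , singleton w' ⊨ ψ)}
  ... | yes found = found
  ... | no none   = ⊥-elim (to (⊨¬ M ψ (ext s)) (from (s≡s' (¬ᵢ ψ)) s'⊨¬ψ) w ws wψ)
    where
      s'⊨¬ψ : M' , ext' s' ⊨ ¬ᵢ ψ
      s'⊨¬ψ = from (⊨¬ M' ψ (ext' s')) (λ w' w's' w'ψ → none (w' , w's' , w'ψ))

  conjoin : ∀ {w} φs → All (positiveType w) φs →
            Σ (InqML {I}) λ ψ → (M , singleton w ⊨ ψ) ×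
              (∀ w' → ε' w' s' → M' , singleton w' ⊨ ψ →
                 All (Sat 𝔐' (λ _ → s') (extend 𝔐' w' ρ₀)) φs)
  conjoin []       []       = ⊤ᵢ , ⊨⊤ᵢ M _ , λ _ _ _ → []
  conjoin {w} (_ ∷ φs) ((χ , refl , _ , wχ) ∷ ps) =
    let (ψ , wψ , transfer) = conjoin φs ps in
    (χ ∧ᵢ ψ) , (to (standardTranslation-correct 𝔐 _ χ w) wχ , wψ) ,
    λ w' w's' (w'χ , w'ψ) →
      (w's' , from (standardTranslation-correct 𝔐' _ χ w') w'χ) ∷ transfer w' w's' w'ψ

  positiveType-finitelySatisfiable : ∀ {w} → ε w s →
    FinitelySatisfiable 𝔐' (λ _ → s') (positiveType w)
  positiveType-finitelySatisfiable ws φs ps =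
    let (ψ , wψ , transfer) = conjoin φs ps
        (w' , w's' , w'ψ)   = supportingWorld ws ψ wψ
    in extend 𝔐' w' ρ₀ , transfer w' w's' w'ψ

  matchingWorld : ∀ w → ε w s → Σ W' λ w' → ε' w' s' × InqEquiv M (singleton w) M' (singleton w')
  matchingWorld w ws = w' , w's' , λ χ → mk⇔ (preserved χ) (reflected χ)
    where
      realised : Realised 𝔐' (λ _ → s') (positiveType w)
      realised = saturated' 1 stateSort (λ _ → s') (wS ∷ []) (positiveType w)
                   (positiveType-finitelySatisfiable ws)
      w' : W'
      w' = proj₁ realised vz

      ρ≗ : proj₁ realised ≗ᵉ extend 𝔐' w' ρ₀
      ρ≗ vz = refl

      satisfies : ∀ χ → M , singleton w ⊨ χ → Sat 𝔐' (λ _ → s') (extend 𝔐' w' ρ₀) (inState∧ χ)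
      satisfies χ wχ = Sat-cong 𝔐' _ ρ≗ (inState∧ χ)
        (proj₂ realised _ (χ , refl , ws , from (standardTranslation-correct 𝔐 _ χ w) wχ))

      w's' : ε' w' s'
      w's' = proj₁ (satisfies ⊤ᵢ (⊨⊤ᵢ M _))

      preserved : ∀ χ → M , singleton w ⊨ χ → M' , singleton w' ⊨ χ
      preserved χ wχ = to (standardTranslation-correct 𝔐' _ χ w') (proj₂ (satisfies χ wχ))

      reflected : ∀ χ → M' , singleton w' ⊨ χ → M , singleton w ⊨ χ
      reflected χ w'χ with em {M , singleton w ⊨ χ}
      ... | yes wχ  = wχ
      ... | no w⊭χ = ⊥-elim (to (⊨¬ M' χ (singleton w'))
                        (preserved (¬ᵢ χ) (from (⊨¬ M χ (singleton w)) λ { _ refl → w⊭χ }))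
                        w' refl w'χ)

mainTheorem6 :
    -- classical metatheory (as in the paper)
    ExcludedMiddle 0ℓ → ExcludedMiddle (lsuc 0ℓ) →
    (I : Set) → AtMostCountable I →
    (𝔐 𝔐' : RelPseudoModel {I}) →
    (s : RelPseudoModel.S 𝔐) → (s' : RelPseudoModel.S 𝔐') →
    ωSaturated 𝔐 → ωSaturated 𝔐' →
    InqEquiv (closure (induced 𝔐)) (RelPseudoModel.ext 𝔐 s)
             (closure (induced 𝔐')) (RelPseudoModel.ext 𝔐' s')
    ⇔
    ((∀ w → RelPseudoModel.ε 𝔐 w s →
       Σ (RelPseudoModel.W 𝔐') λ w' → RelPseudoModel.ε 𝔐' w' s' ×
         InqEquiv (induced 𝔐) (singleton w) (induced 𝔐') (singleton w'))
     ×
     (∀ w' → RelPseudoModel.ε 𝔐' w' s' →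
       Σ (RelPseudoModel.W 𝔐) λ w → RelPseudoModel.ε 𝔐 w s ×
         InqEquiv (induced 𝔐) (singleton w) (induced 𝔐') (singleton w')))
mainTheorem6 _ em _ _ 𝔐 𝔐' s s' saturated saturated' =
  ⇔.trans (InqEquiv-closure (induced 𝔐) (induced 𝔐') _ _) (mk⇔
    (λ s≡s' →
       matchingWorld em 𝔐 𝔐' s s' saturated' s≡s' ,
       λ w' w's' → let (w , ws , w'≡w) = matchingWorld em 𝔐' 𝔐 s' s saturated (InqEquiv-sym s≡s') w' w's'
                   in w , ws , InqEquiv-sym w'≡w)
    (λ (forth , back) → matchings⇒InqEquiv forth back))
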